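{- Let $F$ and $G$ be nonempty graphs without isolated vertices such that there is no graph homomorphism from $G$ to $F$. Then $$\mathrm{ex}_F(n,G)\ge \frac{1}{v(F)^2}n^2-o(n^2)\quad (n\to\infty).$$
   Context: All graphs are simple; $v(F)$ is the number of vertices of $F$. $\mathrm{ex}_F(n,G)$ is the maximum $k$ such that there exist $k$ pairwise edge-disjoint subgraphs $F_1,\dots,F_k$ of $K_n$, each isomorphic to $F$, such that $\bigcup_i F_i$ contains no subgraph $G'$ isomorphic to $G$ with $|E(G')\cap E(F_i)|\le 1$ for every $i$. -}

module Defs where

open import Level using (0ℓ)
open import Data.Nat using (ℕ; _≤_; _*_; _+_)
open import Data.Fin using (Fin)
open import Data.Product using (Σ; ∃; _×_)
open import Data.Sum using (_⊎_)
open import Data.Empty using (⊥)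
open import Relation.Nullary using (¬_)
open import Relation.Binary.PropositionalEquality using (_≡_; _≢_)
open import Function.Definitions using (Injective)

record Graph : Set₁ where
  field
    V     : ℕ
    adj   : Fin V → Fin V → Set
    sym   : ∀ {x y} → adj x y → adj y x
    irrefl : ∀ {x} → ¬ adj x x
open Graph public

v : Graph → ℕ
v F = V F

Nonempty : Graph → Set
Nonempty G = Σ (Fin (V G)) λ x → Σ (Fin (V G)) λ y → adj G x y

NoIsolated : Graph → Set
NoIsolated G = ∀ (x : Fin (V G)) → Σ (Fin (V G)) λ y → adj G x y

Hom : Graph → Graph → Set
Hom G F = Σ (Fin (V G) → Fin (V F)) λ f →
  ∀ {x y} → adj G x y → adj F (f x) (f y)

-- A family of k subgraphs of K_n each isomorphic to F: copy i is the image
-- of an injective map Fin (V F) → Fin n, with edge set the image of E(F).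
Family : Graph → ℕ → ℕ → Set
Family F n k = Fin k → Σ (Fin (V F) → Fin n) (Injective _≡_ _≡_)

InCopy : ∀ {F n k} → Family F n k → Fin k → Fin n → Fin n → Set
InCopy {F} φ i a b = Σ (Fin (V F)) λ u → Σ (Fin (V F)) λ w →
  adj F u w × (Data.Product.proj₁ (φ i) u ≡ a) × (Data.Product.proj₁ (φ i) w ≡ b)

EdgeDisjoint : ∀ {F n k} → Family F n k → Set
EdgeDisjoint {F} {n} {k} φ = ∀ (i j : Fin k) (a b : Fin n) →
  InCopy {F} φ i a b → InCopy {F} φ j a b → i ≡ j

SameEdge : ∀ {q} → Fin q → Fin q → Fin q → Fin q → Set
SameEdge x y x' y' = (x ≡ x' × y ≡ y') ⊎ (x ≡ y' × y ≡ x')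

-- A copy G' of G inside the union of the family (given by an injective
-- vertex map ψ, edges = images of E(G)) such that |E(G') ∩ E(F_i)| ≤ 1 ∀ i.
BadCopy : ∀ {F n k} → Graph → Family F n k → Set
BadCopy {F} {n} {k} G φ = Σ (Fin (V G) → Fin n) λ ψ →
  Injective _≡_ _≡_ ψ ×
  (∀ {x y} → adj G x y → Σ (Fin k) λ i → InCopy {F} φ i (ψ x) (ψ y)) ×
  (∀ (i : Fin k) {x y x' y'} → adj G x y → adj G x' y' →
     InCopy {F} φ i (ψ x) (ψ y) → InCopy {F} φ i (ψ x') (ψ y') → SameEdge x y x' y')

Admissible : Graph → Graph → ℕ → ℕ → Set
Admissible F G n k = Σ (Family F n k) λ φ → EdgeDisjoint {F} φ × ¬ BadCopy {F} G φ

-- Let M ≡ 1 (mod v(F)!), so that M is coprime to every 1 ≤ d < v(F).  In the blow-up of F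
-- with parts of size M, each pair (a , b) ∈ ℤ_M² gives a copy of F sending vertex u to the
-- vertex a + b·u (mod M) of part u.  Two copies sharing an edge agree at two distinct
-- positions u, w; as u − w is invertible modulo M the two lines coincide, so the M² copies
-- are edge-disjoint.  Their union lies in the blow-up of F, into which G has no copy at all
-- since G has no homomorphism to F.  Taking M as large as v(F)·M ≤ n allows gives
-- M² ≥ n²/v(F)² − o(n²) copies.
module Submission where

open import Data.Nat
open import Data.Nat.Properties
open import Data.Nat.DivMod hiding (_mod_)
open import Data.Nat.Divisibility
open import Data.Nat.Coprimality using (Coprime; coprime-divisor)
open import Data.Nat.Tactic.RingSolver using (solve-∀)
open import Data.Product using (Σ; ∃; ∃₂; _×_; _,_; proj₁; proj₂; uncurry)
open import Data.Sum using (inj₁; inj₂)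
open import Relation.Binary.PropositionalEquality
open import Relation.Binary.Definitions using (tri<; tri≈; tri>)
open import Relation.Nullary using (¬_)
open import Data.Empty using (⊥-elim)
open import Data.Fin using (Fin; toℕ; fromℕ<; combine; remQuot; inject≤)
open import Data.Fin.Properties using (nonZeroIndex; toℕ-injective; toℕ-fromℕ<; toℕ<n; combine-injective; combine-remQuot; inject≤-injective)
open import Defs hiding (sym)

-- Multiples of M are added on both sides so that no truncated subtraction occurs.
infix 4 _≡_mod_
_≡_mod_ : ℕ → ℕ → ℕ → Set
_≡_mod_ x y M = ∃₂ λ r s → x + r * M ≡ y + s * M

module _ {M : ℕ} where

  ≡-mod-sym : ∀ {x y} → x ≡ y mod M → y ≡ x mod M
  ≡-mod-sym (r , s , eq) = s , r , sym eq

  ≡-mod-+ : ∀ {x y u v} → x ≡ y mod M → u ≡ v mod M → x + u ≡ y + v mod M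
  ≡-mod-+ {x} {y} {u} {v} (r , s , e) (r′ , s′ , e′) = r + r′ , s + s′ , (begin
      x + u + (r + r′) * M       ≡⟨ interchange x u r r′ M ⟩
      (x + r * M) + (u + r′ * M) ≡⟨ cong₂ _+_ e e′ ⟩
      (y + s * M) + (v + s′ * M) ≡⟨ interchange y v s s′ M ⟨
      y + v + (s + s′) * M       ∎)
    where
    open ≡-Reasoning
    interchange : ∀ x u r r′ M → x + u + (r + r′) * M ≡ (x + r * M) + (u + r′ * M)
    interchange = solve-∀

  ≡-mod-cancelʳ-+ : ∀ {x y} k → x + k ≡ y + k mod M → x ≡ y mod M
  ≡-mod-cancelʳ-+ {x} {y} k (r , s , e) = r , s , +-cancelʳ-≡ k _ _ (begin
      x + r * M + k   ≡⟨ swap x (r * M) k ⟩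
      x + k + r * M   ≡⟨ e ⟩
      y + k + s * M   ≡⟨ swap y (s * M) k ⟨
      y + s * M + k   ∎)
    where
    open ≡-Reasoning
    swap : ∀ a b c → a + b + c ≡ a + c + b
    swap = solve-∀

  ≤-cancel-coprime : ∀ {d x y} → Coprime M d → x ≤ y → d * x ≡ d * y mod M → x ≡ y mod M
  ≤-cancel-coprime {d} {x} {y} cop x≤y (r , s , e) = q , 0 , (begin
      x + q * M   ≡⟨ cong (x +_) gap≡qM ⟨
      x + gap     ≡⟨ m+[n∸m]≡n x≤y ⟩
      y           ≡⟨ +-identityʳ y ⟨
      y + 0 * M   ∎)
    where
    open ≡-Reasoning
    gap = y ∸ x
    expand : ∀ d x g t → d * (x + g) + t ≡ d * x + (t + d * g)
    expand = solve-∀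
    rM≡sM+d*gap : r * M ≡ s * M + d * gap
    rM≡sM+d*gap = +-cancelˡ-≡ (d * x) _ _ (begin
        d * x + r * M             ≡⟨ e ⟩
        d * y + s * M             ≡⟨ cong (λ z → d * z + s * M) (m+[n∸m]≡n x≤y) ⟨
        d * (x + gap) + s * M     ≡⟨ expand d x gap (s * M) ⟩
        d * x + (s * M + d * gap) ∎)
    M∣d*gap : M ∣ d * gap
    M∣d*gap = ∣m+n∣m⇒∣n (subst (M ∣_) rM≡sM+d*gap (n∣m*n r)) (n∣m*n s)
    open _∣_ (coprime-divisor cop M∣d*gap) renaming (quotient to q; equality to gap≡qM)

  ≡-mod-cancel-coprime : ∀ {d x y} → Coprime M d → d * x ≡ d * y mod M → x ≡ y mod M
  ≡-mod-cancel-coprime {x = x} {y} cop e with ≤-total x y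
  ... | inj₁ x≤y = ≤-cancel-coprime cop x≤y e
  ... | inj₂ y≤x = ≡-mod-sym (≤-cancel-coprime cop y≤x (≡-mod-sym e))

  ≡-mod⇒%≡% : .{{_ : NonZero M}} → ∀ {x y} → x ≡ y mod M → x % M ≡ y % M
  ≡-mod⇒%≡% {x} {y} (r , s , e) = begin
      x % M           ≡⟨ %-remove-+ʳ x (n∣m*n r) ⟨
      (x + r * M) % M ≡⟨ cong (_% M) e ⟩
      (y + s * M) % M ≡⟨ %-remove-+ʳ y (n∣m*n s) ⟩
      y % M           ∎
    where open ≡-Reasoning

  %≡%⇒≡-mod : .{{_ : NonZero M}} → ∀ {x y} → x % M ≡ y % M → x ≡ y mod M
  %≡%⇒≡-mod {x} {y} e = y / M , x / M , (begin
      x + y / M * M                 ≡⟨ cong (_+ y / M * M) (m≡m%n+[m/n]*n x M) ⟩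
      x % M + x / M * M + y / M * M ≡⟨ cong (λ z → z + x / M * M + y / M * M) e ⟩
      y % M + x / M * M + y / M * M ≡⟨ swap (y % M) (x / M * M) (y / M * M) ⟩
      y % M + y / M * M + x / M * M ≡⟨ cong (_+ x / M * M) (m≡m%n+[m/n]*n y M) ⟨
      y + x / M * M                 ∎)
    where
    open ≡-Reasoning
    swap : ∀ a b c → a + b + c ≡ a + c + b
    swap = solve-∀

  ≡-mod⇒≡ : .{{_ : NonZero M}} → ∀ {x y} → x < M → y < M → x ≡ y mod M → x ≡ y
  ≡-mod⇒≡ {x} {y} x<M y<M e =
    trans (sym (m<n⇒m%n≡m x<M)) (trans (≡-mod⇒%≡% e) (m<n⇒m%n≡m y<M))

affine-unique : ∀ {M d q a b a′ b′} .{{_ : NonZero M}} → Coprime M d →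
  a < M → b < M → a′ < M → b′ < M →
  a + b * (q + d) ≡ a′ + b′ * (q + d) mod M → a + b * q ≡ a′ + b′ * q mod M →
  a ≡ a′ × b ≡ b′
affine-unique {M} {d} {q} {a} {b} {a′} {b′} cop a<M b<M a′<M b′<M e₁ e₂ = a≡a′ , b≡b′
  where
  K = a + b * q + (a′ + b′ * q)
  shiftˡ : ∀ a b a′ b′ q d → a + b * (q + d) + (a′ + b′ * q) ≡ d * b + (a + b * q + (a′ + b′ * q))
  shiftˡ = solve-∀
  shiftʳ : ∀ a b a′ b′ q d → a′ + b′ * (q + d) + (a + b * q) ≡ d * b′ + (a + b * q + (a′ + b′ * q))
  shiftʳ = solve-∀
  db≡db′ : d * b ≡ d * b′ mod M
  db≡db′ = ≡-mod-cancelʳ-+ K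
    (subst₂ (_≡_mod M) (shiftˡ a b a′ b′ q d) (shiftʳ a b a′ b′ q d) (≡-mod-+ e₁ (≡-mod-sym e₂)))
  b≡b′ : b ≡ b′
  b≡b′ = ≡-mod⇒≡ b<M b′<M (≡-mod-cancel-coprime cop db≡db′)
  a≡a′ : a ≡ a′
  a≡a′ = ≡-mod⇒≡ a<M a′<M
    (≡-mod-cancelʳ-+ (b * q) (subst (λ z → a + b * q ≡ a′ + z * q mod M) (sym b≡b′) e₂))

m≤n⇒m∣n! : ∀ {m n} .{{_ : NonZero m}} → m ≤ n → m ∣ n !
m≤n⇒m∣n! {suc m} m≤n = ∣-trans (m∣m*n (m !)) (m≤n⇒m!∣n! m≤n)

∣n⇒coprime[1+m*n] : ∀ {d} m {n} → d ∣ n → Coprime (suc (m * n)) d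
∣n⇒coprime[1+m*n] m {n} d∣n {i} (i∣1+mn , i∣d) =
  ∣1⇒≡1 (∣m+n∣m⇒∣n (subst (i ∣_) (+-comm 1 (m * n)) i∣1+mn) (∣n⇒∣m*n m (∣-trans i∣d d∣n)))

1+*!-coprime : ∀ t {f} {u w : Fin f} → toℕ w < toℕ u → Coprime (suc (t * f !)) (toℕ u ∸ toℕ w)
1+*!-coprime t {u = u} {w} w<u = ∣n⇒coprime[1+m*n] t
  (m≤n⇒m∣n! {{>-nonZero (m<n⇒0<n∸m w<u)}} (≤-trans (m∸n≤m (toℕ u) (toℕ w)) (<⇒≤ (toℕ<n u))))

≡1-mod-bracket : ∀ L .{{_ : NonZero L}} q → 1 ≤ q → ∃ λ t → suc (t * L) ≤ q × q ≤ L + t * L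
≡1-mod-bracket L q 1≤q = t , ≤-trans (s≤s (m/n*n≤m (q ∸ 1) L)) (≤-reflexive (m+[n∸m]≡n 1≤q)) , (begin
    q                        ≡⟨ m+[n∸m]≡n 1≤q ⟨
    suc (q ∸ 1)              ≡⟨ cong suc (m≡m%n+[m/n]*n (q ∸ 1) L) ⟩
    suc ((q ∸ 1) % L + t * L) ≤⟨ +-monoˡ-≤ (t * L) (m%n<n (q ∸ 1) L) ⟩
    L + t * L                ∎)
  where
  open ≤-Reasoning
  t = (q ∸ 1) / L

-- Rounding n down to A costs at most c·(2n + c) in n², which is ≤ n²/s once n ≥ c(2 + c)s.
square-slack : ∀ {A c s} n → A ≤ n → n ≤ A + c → c * (2 + c) * s ≤ n →
  n * n * s ≤ A * A * s + n * n
square-slack zero _ _ _ = z≤n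
square-slack {A} {c} {s} n@(suc _) A≤n n≤A+c slack = begin
    n * n * s                       ≤⟨ *-monoˡ-≤ s n*n≤ ⟩
    (A * A + c * (n + n + c)) * s   ≡⟨ *-distribʳ-+ s (A * A) _ ⟩
    A * A * s + c * (n + n + c) * s ≤⟨ +-monoʳ-≤ (A * A * s) cross ⟩
    A * A * s + n * n               ∎
  where
  open ≤-Reasoning
  square-+ : ∀ A c → (A + c) * (A + c) ≡ A * A + c * (A + A + c)
  square-+ = solve-∀
  regroup : ∀ c n s → c * (n + n + c * n) * s ≡ c * (2 + c) * s * n
  regroup = solve-∀
  n*n≤ : n * n ≤ A * A + c * (n + n + c)
  n*n≤ = begin
    n * n                   ≤⟨ *-mono-≤ n≤A+c n≤A+c ⟩
    (A + c) * (A + c)       ≡⟨ square-+ A c ⟩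
    A * A + c * (A + A + c) ≤⟨ +-monoʳ-≤ (A * A) (*-monoʳ-≤ c (+-monoˡ-≤ c (+-mono-≤ A≤n A≤n))) ⟩
    A * A + c * (n + n + c) ∎
  cross : c * (n + n + c) * s ≤ n * n
  cross = begin
    c * (n + n + c) * s     ≤⟨ *-monoˡ-≤ s (*-monoʳ-≤ c (+-monoʳ-≤ (n + n) (m≤m*n c n))) ⟩
    c * (n + n + c * n) * s ≡⟨ regroup c n s ⟩
    c * (2 + c) * s * n     ≤⟨ *-monoˡ-≤ n slack ⟩
    n * n                   ∎

choose-part-size : ∀ f L .{{_ : NonZero f}} .{{_ : NonZero L}} s →
  ∃ λ N → ∀ n → N ≤ n → ∃ λ t →
    f * suc (t * L) ≤ n ×
    n * n * s ≤ suc (t * L) * suc (t * L) * (f * f) * s + n * n * (f * f)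
choose-part-size f L s = N , fits
  where
  N = f * L * (2 + f * L) * s + f
  regroup : ∀ f L x → f + (L + x) * f ≡ f * suc x + f * L
  regroup = solve-∀
  reorder : ∀ f M s → f * M * (f * M) * s ≡ M * M * (f * f) * s
  reorder = solve-∀
  fits : ∀ n → N ≤ n → ∃ λ t →
    f * suc (t * L) ≤ n × n * n * s ≤ suc (t * L) * suc (t * L) * (f * f) * s + n * n * (f * f)
  fits n N≤n with ≡1-mod-bracket L (n / f) (m≥n⇒m/n>0 (≤-trans (m≤n+m f _) N≤n))
  ... | t , M≤q , q≤L+tL = t , fM≤n , (begin
      n * n * s                             ≤⟨ square-slack n fM≤n n≤fM+fL (≤-trans (m≤m+n _ f) N≤n) ⟩
      f * M * (f * M) * s + n * n           ≤⟨ +-mono-≤ (≤-reflexive (reorder f M s)) (m≤m*n (n * n) (f * f) {{m*n≢0 f f}}) ⟩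
      M * M * (f * f) * s + n * n * (f * f) ∎)
    where
    open ≤-Reasoning
    q = n / f
    M = suc (t * L)
    fM≤n : f * M ≤ n
    fM≤n = begin
      f * M ≤⟨ *-monoʳ-≤ f M≤q ⟩
      f * q ≡⟨ *-comm f q ⟩
      q * f ≤⟨ m/n*n≤m n f ⟩
      n     ∎
    n≤fM+fL : n ≤ f * M + f * L
    n≤fM+fL = begin
      n                   ≡⟨ m≡m%n+[m/n]*n n f ⟩
      n % f + q * f       ≤⟨ +-mono-≤ (<⇒≤ (m%n<n n f)) (*-monoˡ-≤ f q≤L+tL) ⟩
      f + (L + t * L) * f ≡⟨ regroup f L (t * L) ⟩
      f * M + f * L       ∎

-- The union of the copies lies in the blow-up of F: no vertex of K_n is used by two
-- different vertices of F.
Partite : ∀ {F n k} → Family F n k → Set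
Partite {F} φ = ∀ i j (u w : Fin (V F)) → proj₁ (φ i) u ≡ proj₁ (φ j) w → u ≡ w

module _ {F G : Graph} {n k} {φ : Family F n k} (partite : Partite {F} φ) (noIsolated : NoIsolated G) where

  covered⇒Hom : (ψ : Fin (V G) → Fin n) →
    (∀ {x y} → adj G x y → Σ (Fin k) λ i → InCopy {F} φ i (ψ x) (ψ y)) → Hom G F
  covered⇒Hom ψ cover = part , part-hom
    where
    part : Fin (V G) → Fin (V F)
    part x = proj₁ (proj₂ (cover (proj₂ (noIsolated x))))
    part-unique : ∀ x i u → proj₁ (φ i) u ≡ ψ x → part x ≡ u
    part-unique x i u eq with cover (proj₂ (noIsolated x))
    ... | i₀ , u₀ , _ , _ , eq₀ , _ = partite i₀ i u₀ u (trans eq₀ (sym eq))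
    part-hom : ∀ {x y} → adj G x y → adj F (part x) (part y)
    part-hom {x} {y} axy with cover axy
    ... | i , u , w , auw , eqx , eqy =
      subst₂ (adj F) (sym (part-unique x i u eqx)) (sym (part-unique y i w eqy)) auw

  partite⇒¬BadCopy : ¬ Hom G F → ¬ BadCopy {F} G φ
  partite⇒¬BadCopy ¬hom (ψ , _ , cover , _) = ¬hom (covered⇒Hom ψ cover)

remQuot-injective : ∀ {m} n {i j : Fin (m * n)} → remQuot {m} n i ≡ remQuot n j → i ≡ j
remQuot-injective {m} n {i} {j} eq = begin
    i                                 ≡⟨ combine-remQuot {m} n i ⟨
    uncurry combine (remQuot {m} n i) ≡⟨ cong (uncurry combine) eq ⟩
    uncurry combine (remQuot {m} n j) ≡⟨ combine-remQuot {m} n j ⟩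
    j                                 ∎
  where open ≡-Reasoning

module AffineCopies (F : Graph) (M : ℕ) .{{_ : NonZero M}} {n} (fM≤n : V F * M ≤ n)
  (coprime : ∀ {u w : Fin (V F)} → toℕ w < toℕ u → Coprime M (toℕ u ∸ toℕ w)) where

  vertex : Fin (V F) → Fin M → Fin n
  vertex u x = inject≤ (combine u x) fM≤n

  vertex-injective : ∀ {u w x y} → vertex u x ≡ vertex w y → u ≡ w × x ≡ y
  vertex-injective {u} {w} {x} {y} eq = combine-injective u x w y (inject≤-injective fM≤n fM≤n _ _ eq)

  line : Fin M → Fin M → Fin (V F) → Fin M
  line a b u = fromℕ< (m%n<n (toℕ a + toℕ b * toℕ u) M)

  line-≡⇒≡-mod : ∀ {a b a′ b′ u} → line a b u ≡ line a′ b′ u →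
    toℕ a + toℕ b * toℕ u ≡ toℕ a′ + toℕ b′ * toℕ u mod M
  line-≡⇒≡-mod eq = %≡%⇒≡-mod (trans (sym (toℕ-fromℕ< _)) (trans (cong toℕ eq) (toℕ-fromℕ< _)))

  lines-meet-once : ∀ {a b a′ b′} {u w : Fin (V F)} → toℕ w < toℕ u →
    line a b u ≡ line a′ b′ u → line a b w ≡ line a′ b′ w → a ≡ a′ × b ≡ b′
  lines-meet-once {a} {b} {a′} {b′} {u} {w} w<u eq-u eq-w =
    let a≡a′ , b≡b′ = affine-unique (coprime w<u) (toℕ<n a) (toℕ<n b) (toℕ<n a′) (toℕ<n b′)
                        at-u (line-≡⇒≡-mod {a} {b} {a′} {b′} {w} eq-w)
    in toℕ-injective a≡a′ , toℕ-injective b≡b′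
    where
    at-u : toℕ a + toℕ b * (toℕ w + (toℕ u ∸ toℕ w))
         ≡ toℕ a′ + toℕ b′ * (toℕ w + (toℕ u ∸ toℕ w)) mod M
    at-u = subst (λ p → toℕ a + toℕ b * p ≡ toℕ a′ + toℕ b′ * p mod M)
            (sym (m+[n∸m]≡n (<⇒≤ w<u))) (line-≡⇒≡-mod {a} {b} {a′} {b′} {u} eq-u)

  line-of : Fin (M * M) → Fin (V F) → Fin M
  line-of i = uncurry line (remQuot M i)

  copy : Fin (M * M) → Fin (V F) → Fin n
  copy i u = vertex u (line-of i u)

  agree-twice⇒≡ : ∀ {i j u w} → toℕ w < toℕ u →
    line-of i u ≡ line-of j u → line-of i w ≡ line-of j w → i ≡ j
  agree-twice⇒≡ w<u eq-u eq-w = remQuot-injective M (uncurry (cong₂ _,_) (lines-meet-once w<u eq-u eq-w))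

  copies : Family F n (M * M)
  copies i = copy i , λ eq → proj₁ (vertex-injective eq)

  copies-partite : Partite {F} copies
  copies-partite i j u w eq = proj₁ (vertex-injective eq)

  copies-edgeDisjoint : EdgeDisjoint {F} copies
  copies-edgeDisjoint i j a b (u , w , auw , eqa , eqb) (u′ , w′ , _ , eqa′ , eqb′)
    with vertex-injective (trans eqa (sym eqa′)) | vertex-injective (trans eqb (sym eqb′))
  ... | refl , eq-u | refl , eq-w with <-cmp (toℕ u) (toℕ w)
  ... | tri< u<w _ _ = agree-twice⇒≡ u<w eq-w eq-u
  ... | tri≈ _ u≡w _ = ⊥-elim (irrefl F (subst (adj F u) (toℕ-injective (sym u≡w)) auw))
  ... | tri> _ _ w<u = agree-twice⇒≡ w<u eq-u eq-w

  copies-admissible : ∀ {G} → NoIsolated G → ¬ Hom G F → Admissible F G n (M * M)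
  copies-admissible {G} noIsolated ¬hom =
    copies , copies-edgeDisjoint , partite⇒¬BadCopy {F} {G} {φ = copies} copies-partite noIsolated ¬hom

theorem7 : (F G : Graph) → Nonempty F → NoIsolated F → Nonempty G → NoIsolated G →
    ¬ Hom G F →
    (m : ℕ) → Σ ℕ λ N → (n : ℕ) → N ≤ n →
      Σ ℕ λ k → Admissible F G n k ×
        (n * n * suc m ≤ k * (v F * v F) * suc m + n * n * (v F * v F))
theorem7 F G (x , _) _ _ noIsolatedG ¬hom m with choose-part-size (V F) (V F !) {{nonZeroIndex x}} {{V F !≢0}} (suc m)
... | N , fits = N , λ n N≤n →
  let t , fM≤n , bound = fits n N≤n
      M = suc (t * V F !)
  in M * M , AffineCopies.copies-admissible F M fM≤n (1+*!-coprime t) {G} noIsolatedG ¬hom , bound
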